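{- Let $\mathcal T$ be a planar or toric trinity, $s$ a state, and $S$ a set of clockwise (respectively, counter-clockwise) empty black triangles of $s$. Then the triangles of $S$ can be changed one after another (by clockwise, respectively counter-clockwise, moves) in any order, and the resulting state is the same regardless of the order in which they are changed.
   Context: A trinity is a triangulation $\mathcal T$ of a compact connected oriented closed surface $\Sigma$ whose vertices are colored red, green, blue so that the endpoints of every edge have different colors. A triangle is black if its vertices, read clockwise, appear in the cyclic order blue, green, red; otherwise white. A toric trinity is a trinity on the torus; a planar trinity is a trinity on $S^2$ with a chosen white triangle called outer, whose vertices are called roots. A state of a toric trinity is a bijection between white triangles and vertices matching each white triangle with one of its own vertices; for a planar trinity, between non-outer white triangles and non-root vertices. For a black triangle $\Delta$ with vertices $u_1,u_2,u_3$ in clockwise order and $W_i$ the white triangle sharing the edge $u_iu_{i+1}$ with $\Delta$ (indices mod 3): $\Delta$ is a clockwise empty black triangle of $s$ if $s$ matches $W_i$ with $u_{i+1}$ for all $i$, and counter-clockwise empty if $s$ matches $W_i$ with $u_i$ for all $i$. The clockwise move changing a clockwise empty $\Delta$ replaces the pairs $(W_i,u_{i+1})$ by $(W_i,u_i)$ and leaves all other pairs unchanged; the counter-clockwise move is its inverse. -}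

module Defs where

open import Data.Nat using (ℕ; zero; suc; _+_; _*_; _<_)
open import Data.Fin using (Fin; zero; suc; _≟_)
open import Data.Product using (Σ; ∃; ∃-syntax; _×_; _,_; proj₁; proj₂)
open import Data.Sum using (_⊎_)
open import Data.Unit using (⊤)
open import Data.List using (List; []; _∷_)
open import Relation.Nullary using (¬_; yes; no)
open import Relation.Binary.PropositionalEquality using (_≡_; _≢_)

-- Conventions
--   * Colours are Fin 3 : red = 0, green = 1, blue = 2.
--   * A triangle Δ has three corners 0,1,2 listed in CLOCKWISE order
--     (w.r.t. the orientation of the surface).
--   * Side i of Δ is the edge from corner i to corner (i+1 mod 3).
--   * A closed oriented surface is obtained by gluing the sides of the
--     triangles in pairs (fixed-point-free involution `glue`), orientation
--     coherently: if side (Δ,i) is glued to side (Δ',j) then corner j of Δ'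
--     is corner i+1 of Δ and corner j+1 of Δ' is corner i of Δ.
--   * Vertices are Fin nV; `corner` sends each corner to its vertex; the
--     fibres of `corner` are exactly the orbits of the rotation around a
--     vertex (so vertices = equivalence classes of corners).

red green blue : Fin 3
red = zero
green = suc zero
blue = suc (suc zero)

next3 : Fin 3 → Fin 3
next3 zero = suc zero
next3 (suc zero) = suc (suc zero)
next3 (suc (suc zero)) = zero

Side : ℕ → Set
Side nT = Fin nT × Fin 3

data Reach {nT : ℕ} (glue : Side nT → Side nT) : Fin nT → Fin nT → Set where
  here : ∀ {Δ} → Reach glue Δ Δ
  step : ∀ {Δ Δ''} (i : Fin 3) → Reach glue (proj₁ (glue (Δ , i))) Δ'' → Reach glue Δ Δ''

-- rotation of a corner around its vertex
rot : {nT : ℕ} → (Side nT → Side nT) → Side nT → Side nT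
rot glue c = proj₁ (glue c) , next3 (proj₂ (glue c))

rotN : {nT : ℕ} → (Side nT → Side nT) → ℕ → Side nT → Side nT
rotN glue zero c = c
rotN glue (suc k) c = rotN glue k (rot glue c)

-- A 3-coloured triangulation (trinity) of a compact connected oriented
-- closed surface.
record Trinity : Set where
  field
    nT nV : ℕ
    nonempty : 0 < nT
    glue : Side nT → Side nT
    glue-invol : ∀ x → glue (glue x) ≡ x
    glue-nofix : ∀ x → glue x ≢ x
    corner : Fin nT → Fin 3 → Fin nV
    corner-glue₁ : ∀ Δ i → corner (proj₁ (glue (Δ , i))) (proj₂ (glue (Δ , i))) ≡ corner Δ (next3 i)
    corner-glue₂ : ∀ Δ i → corner (proj₁ (glue (Δ , i))) (next3 (proj₂ (glue (Δ , i)))) ≡ corner Δ i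
    corner-onto : ∀ v → ∃[ c ] corner (proj₁ c) (proj₂ c) ≡ v
    corner-orbit : ∀ c c' → corner (proj₁ c) (proj₂ c) ≡ corner (proj₁ c') (proj₂ c') →
                   ∃[ k ] rotN glue k c ≡ c'
    connected : ∀ Δ Δ' → Reach glue Δ Δ'
    colour : Fin nV → Fin 3
    proper : ∀ Δ i → colour (corner Δ i) ≢ colour (corner Δ (next3 i))

module _ (T : Trinity) where
  open Trinity T

  col : Fin nT → Fin 3 → Fin 3
  col Δ i = colour (corner Δ i)

  Black : Fin nT → Set
  Black Δ = (col Δ zero ≡ blue × col Δ (suc zero) ≡ green × col Δ (suc (suc zero)) ≡ red)
          ⊎ (col Δ zero ≡ green × col Δ (suc zero) ≡ red × col Δ (suc (suc zero)) ≡ blue)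
          ⊎ (col Δ zero ≡ red × col Δ (suc zero) ≡ blue × col Δ (suc (suc zero)) ≡ green)

  White : Fin nT → Set
  White Δ = ¬ Black Δ

  -- toric (Euler characteristic 0) or planar (Euler characteristic 2, with
  -- a chosen white outer triangle).  χ = V - E + F = nV - 3nT/2 + nT.
  data Kind : Set where
    toric  : 2 * nV ≡ nT → Kind
    planar : 2 * nV ≡ nT + 4 → (outer : Fin nT) → White outer → Kind

  ActiveTri : Kind → Fin nT → Set
  ActiveTri (toric _) W = White W
  ActiveTri (planar _ o _) W = White W × W ≢ o

  ActiveVert : Kind → Fin nV → Set
  ActiveVert (toric _) v = ⊤
  ActiveVert (planar _ o _) v = ∀ i → corner o i ≢ v

  -- A state is encoded by s : Fin nT → Fin 3, matching the (active) white
  -- triangle W with its own vertex  corner W (s W);  values of s on other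
  -- triangles are irrelevant.
  StateFn : Set
  StateFn = Fin nT → Fin 3

  matched : StateFn → Fin nT → Fin nV
  matched s W = corner W (s W)

  record IsState (k : Kind) (s : StateFn) : Set where
    field
      maps-to : ∀ W → ActiveTri k W → ActiveVert k (matched s W)
      inj : ∀ W W' → ActiveTri k W → ActiveTri k W' → matched s W ≡ matched s W' → W ≡ W'
      surj : ∀ v → ActiveVert k v → ∃[ W ] (ActiveTri k W × matched s W ≡ v)

  SameState : Kind → StateFn → StateFn → Set
  SameState k s s' = ∀ W → ActiveTri k W → s W ≡ s' W

  -- W_i : the triangle across side i of Δ (sharing edge u_i u_{i+1})
  adj : Fin nT → Fin 3 → Fin nT
  adj Δ i = proj₁ (glue (Δ , i))

  adjSide : Fin nT → Fin 3 → Fin 3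
  adjSide Δ i = proj₂ (glue (Δ , i))

  data Dir : Set where
    cw ccw : Dir

  Empty : Kind → Dir → StateFn → Fin nT → Set
  Empty k cw s Δ = Black Δ × (∀ i → ActiveTri k (adj Δ i) × matched s (adj Δ i) ≡ corner Δ (next3 i))
  Empty k ccw s Δ = Black Δ × (∀ i → ActiveTri k (adj Δ i) × matched s (adj Δ i) ≡ corner Δ i)

  -- the corner of W_i that the move assigns to W_i:
  --   cw move  : W_i ↦ u_i      (corner next3 (adjSide Δ i) of W_i)
  --   ccw move : W_i ↦ u_{i+1}  (corner adjSide Δ i of W_i)
  target : Dir → Fin nT → Fin 3 → Fin 3
  target cw Δ i = next3 (adjSide Δ i)
  target ccw Δ i = adjSide Δ i

  move : Dir → StateFn → Fin nT → StateFn
  move d s Δ W with W ≟ adj Δ zero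
  ... | yes _ = target d Δ zero
  ... | no _ with W ≟ adj Δ (suc zero)
  ...   | yes _ = target d Δ (suc zero)
  ...   | no _ with W ≟ adj Δ (suc (suc zero))
  ...     | yes _ = target d Δ (suc (suc zero))
  ...     | no _ = s W

  moveAll : Dir → StateFn → List (Fin nT) → StateFn
  moveAll d s [] = s
  moveAll d s (Δ ∷ L) = moveAll d (move d s Δ) L

  Changeable : Kind → Dir → StateFn → List (Fin nT) → Set
  Changeable k d s [] = IsState k s
  Changeable k d s (Δ ∷ L) = IsState k s × Empty k d s Δ × Changeable k d (move d s Δ) L

-- A (counter-)clockwise move at an empty black triangle x only
-- rewrites the state on the three white neighbours W_0, W_1, W_2 of x, and
-- it merely permutes the three vertices of x among them.  Hence
--   (1) the move turns a state into a state;
--   (2) the value of the state on a neighbour W of an empty triangle x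
--       determines the side of W glued to x, so two distinct empty
--       triangles of one state have disjoint neighbourhoods;
--   (3) a move at x leaves every triangle with neighbourhood disjoint from
--       that of x empty, and moves at triangles with disjoint
--       neighbourhoods commute.
-- A list of triangles with pairwise disjoint neighbourhoods is called
-- independent.  By (3) an independent list of empty triangles can be
-- changed one after the other, and by commutation the result does not
-- depend on the order; by (2) the set S of the theorem is independent, and
-- independence is invariant under permutation.
module Submission where

open import Defs
open import Data.Fin using (Fin; zero; suc; _≟_)
open import Data.Sum using (_⊎_; inj₁; inj₂)
open import Data.Product using (_×_; ∃-syntax; _,_; proj₁; proj₂)
open import Data.List using (List; []; _∷_)
open import Data.List.Relation.Unary.All using (All; []; _∷_)
open import Data.List.Relation.Unary.AllPairs using (AllPairs; []; _∷_)
open import Data.List.Relation.Unary.Unique.Propositional using (Unique)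
open import Data.List.Relation.Binary.Permutation.Propositional
  using (_↭_; refl; prep; swap; trans; ↭-sym; ↭⇒↭ₛ)
open import Data.List.Relation.Binary.Permutation.Propositional.Properties using (All-resp-↭)
import Data.List.Relation.Binary.Permutation.Setoid.Properties as SetoidPermutation
open import Relation.Nullary using (yes; no; contradiction)
open import Relation.Binary.PropositionalEquality as ≡
  using (_≡_; _≢_; refl; sym; cong; cong₂; subst; resp₂)

next3-injective : ∀ {a b} → next3 a ≡ next3 b → a ≡ b
next3-injective {zero}           {zero}           _  = refl
next3-injective {suc zero}       {suc zero}       _  = refl
next3-injective {suc (suc zero)} {suc (suc zero)} _  = refl
next3-injective {zero}           {suc zero}       ()
next3-injective {zero}           {suc (suc zero)} ()
next3-injective {suc zero}       {zero}           ()
next3-injective {suc zero}       {suc (suc zero)} ()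
next3-injective {suc (suc zero)} {zero}           ()
next3-injective {suc (suc zero)} {suc zero}       ()

module _ (T : Trinity) where
  open Trinity T

  corners-distinct : ∀ W p q → corner W p ≡ corner W q → p ≡ q
  corners-distinct W zero             zero             e = refl
  corners-distinct W (suc zero)       (suc zero)       e = refl
  corners-distinct W (suc (suc zero)) (suc (suc zero)) e = refl
  corners-distinct W zero             (suc zero)       e = contradiction (cong colour e) (proper W zero)
  corners-distinct W (suc zero)       (suc (suc zero)) e = contradiction (cong colour e) (proper W (suc zero))
  corners-distinct W (suc (suc zero)) zero             e = contradiction (cong colour e) (proper W (suc (suc zero)))
  corners-distinct W (suc zero)       zero             e = contradiction (cong colour (sym e)) (proper W zero)
  corners-distinct W (suc (suc zero)) (suc zero)       e = contradiction (cong colour (sym e)) (proper W (suc zero))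
  corners-distinct W zero             (suc (suc zero)) e = contradiction (cong colour (sym e)) (proper W (suc (suc zero)))

  glue-injective : ∀ {a b} → glue a ≡ glue b → a ≡ b
  glue-injective {a} {b} e = ≡.trans (sym (glue-invol a)) (≡.trans (cong glue e) (glue-invol b))

  -- The vertex of x matched with the neighbour W_j before and after the
  -- move at x in direction d: for cw, u_{j+1} before and u_j after; for
  -- ccw the other way round.
  before after : Dir T → Fin nT → Fin 3 → Fin nV
  before cw  x j = corner x (next3 j)
  before ccw x j = corner x j
  after  cw  x j = corner x j
  after  ccw x j = corner x (next3 j)

  before-injective : ∀ d x {i j} → before d x i ≡ before d x j → i ≡ j
  before-injective cw  x e = next3-injective (corners-distinct x _ _ e)
  before-injective ccw x e = corners-distinct x _ _ e

  after-injective : ∀ d x {i j} → after d x i ≡ after d x j → i ≡ j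
  after-injective cw  x e = corners-distinct x _ _ e
  after-injective ccw x e = next3-injective (corners-distinct x _ _ e)

  after-among-before : ∀ d x j → ∃[ j' ] before d x j' ≡ after d x j
  after-among-before cw  x zero             = suc (suc zero) , refl
  after-among-before cw  x (suc zero)       = zero , refl
  after-among-before cw  x (suc (suc zero)) = suc zero , refl
  after-among-before ccw x j                = next3 j , refl

  before-among-after : ∀ d x j → ∃[ j' ] after d x j' ≡ before d x j
  before-among-after cw  x j                = next3 j , refl
  before-among-after ccw x zero             = suc (suc zero) , refl
  before-among-after ccw x (suc zero)       = zero , refl
  before-among-after ccw x (suc (suc zero)) = suc zero , refl

  beforeCorner : Dir T → Fin nT → Fin 3 → Fin 3
  beforeCorner cw  x i = adjSide T x i
  beforeCorner ccw x i = next3 (adjSide T x i)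

  beforeCorner-vertex : ∀ d x i → corner (adj T x i) (beforeCorner d x i) ≡ before d x i
  beforeCorner-vertex cw  x i = corner-glue₁ x i
  beforeCorner-vertex ccw x i = corner-glue₂ x i

  beforeCorner-determines-side : ∀ d x y {i j} →
    beforeCorner d x i ≡ beforeCorner d y j → adjSide T x i ≡ adjSide T y j
  beforeCorner-determines-side cw  x y e = e
  beforeCorner-determines-side ccw x y e = next3-injective e

  target-vertex : ∀ d x j → corner (adj T x j) (target T d x j) ≡ after d x j
  target-vertex cw  x j = corner-glue₂ x j
  target-vertex ccw x j = corner-glue₁ x j

  NeighboursMatched : Kind T → Dir T → StateFn T → Fin nT → Set
  NeighboursMatched k d s x = ∀ i → ActiveTri T k (adj T x i) × matched T s (adj T x i) ≡ before d x i

  empty-neighbours : ∀ {k d s x} → Empty T k d s x → NeighboursMatched k d s x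
  empty-neighbours {d = cw}  (_ , n) = n
  empty-neighbours {d = ccw} (_ , n) = n

  empty-from-neighbours : ∀ {k d s s' x} → Empty T k d s x → NeighboursMatched k d s' x → Empty T k d s' x
  empty-from-neighbours {d = cw}  (black , _) n = black , n
  empty-from-neighbours {d = ccw} (black , _) n = black , n

  empty-active : ∀ {k d s x} → Empty T k d s x → ∀ i → ActiveTri T k (adj T x i)
  empty-active ex i = proj₁ (empty-neighbours ex i)

  empty-matched : ∀ {k d s x} → Empty T k d s x → ∀ i → matched T s (adj T x i) ≡ before d x i
  empty-matched ex i = proj₂ (empty-neighbours ex i)

  empty-neighbours-distinct : ∀ {k d s x} → Empty T k d s x → ∀ {i j} → adj T x i ≡ adj T x j → i ≡ j
  empty-neighbours-distinct {d = d} {s} {x} ex {i} {j} e =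
    before-injective d x (≡.trans (sym (empty-matched ex i)) (≡.trans (cong (matched T s) e) (empty-matched ex j)))

  Disjoint : Fin nT → Fin nT → Set
  Disjoint x y = ∀ i j → adj T x i ≢ adj T y j

  Disjoint-sym : ∀ {x y} → Disjoint x y → Disjoint y x
  Disjoint-sym dj i j e = dj j i (sym e)

  -- Distinct empty triangles of one state have disjoint neighbourhoods:
  -- the value of s on a common neighbour W would single out the side of W
  -- glued to both of them.
  empty-disjoint : ∀ {k d s x y} → Empty T k d s x → Empty T k d s y → x ≢ y → Disjoint x y
  empty-disjoint {d = d} {s} {x} {y} ex ey x≢y i j e = x≢y (cong proj₁ (glue-injective (cong₂ _,_ e sameSide)))
    where
      valueAt : ∀ {z} → Empty T _ d s z → ∀ l → s (adj T z l) ≡ beforeCorner d z l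
      valueAt {z} ez l = corners-distinct (adj T z l) _ _
        (≡.trans (empty-matched ez l) (sym (beforeCorner-vertex d z l)))

      sameSide : adjSide T x i ≡ adjSide T y j
      sameSide = beforeCorner-determines-side d x y
        (≡.trans (sym (valueAt ex i)) (≡.trans (cong s e) (valueAt ey j)))

  Outside : Fin nT → Fin nT → Set
  Outside x W = ∀ j → W ≢ adj T x j

  data MoveView (d : Dir T) (x W : Fin nT) : Set where
    untouched  : Outside x W → (∀ s → move T d s x W ≡ s W) → MoveView d x W
    reassigned : ∀ j → W ≡ adj T x j → (∀ s → move T d s x W ≡ target T d x j) → MoveView d x W

  -- Computed through a sum whose type mentions `move`, so that the case
  -- analysis on `W ≟ adj T x j` below also unfolds `move`.
  moveView : ∀ d x W → MoveView d x W
  moveView d x W = fromCases (cases W)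
    where
      Cases : Fin nT → Set
      Cases W = (Outside x W × (∀ s → move T d s x W ≡ s W))
              ⊎ ∃[ j ] (W ≡ adj T x j × (∀ s → move T d s x W ≡ target T d x j))

      fromCases : ∀ {W} → Cases W → MoveView d x W
      fromCases (inj₁ (out , m))   = untouched out m
      fromCases (inj₂ (j , e , m)) = reassigned j e m

      cases : ∀ W → Cases W
      cases W with W ≟ adj T x zero
      ... | yes e = inj₂ (zero , e , λ _ → refl)
      ... | no n₀ with W ≟ adj T x (suc zero)
      ...   | yes e = inj₂ (suc zero , e , λ _ → refl)
      ...   | no n₁ with W ≟ adj T x (suc (suc zero))
      ...     | yes e = inj₂ (suc (suc zero) , e , λ _ → refl)
      ...     | no n₂ = inj₁ (outside , λ _ → refl)
        where
          outside : Outside x W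
          outside zero             = n₀
          outside (suc zero)       = n₁
          outside (suc (suc zero)) = n₂

  move-cong : ∀ d {s s'} x → (∀ W → s W ≡ s' W) → ∀ W → move T d s x W ≡ move T d s' x W
  move-cong d {s} {s'} x s≗s' W with moveView d x W
  ... | untouched _ m      = ≡.trans (m s) (≡.trans (s≗s' W) (sym (m s')))
  ... | reassigned _ _ m   = ≡.trans (m s) (sym (m s'))

  moveAll-cong : ∀ d {s s'} L → (∀ W → s W ≡ s' W) → ∀ W → moveAll T d s L W ≡ moveAll T d s' L W
  moveAll-cong d []      s≗s' = s≗s'
  moveAll-cong d (x ∷ L) s≗s' = moveAll-cong d L (move-cong d x s≗s')

  moves-commute : ∀ d s {x y} → Disjoint x y → ∀ W →
                  move T d (move T d s x) y W ≡ move T d (move T d s y) x W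
  moves-commute d s {x} {y} dj W with moveView d x W | moveView d y W
  ... | reassigned i e _   | reassigned j e' _ = contradiction (≡.trans (sym e) e') (dj i j)
  ... | reassigned _ _ mx  | untouched _ my    = ≡.trans (my _) (≡.trans (mx s) (sym (mx _)))
  ... | untouched _ mx     | reassigned _ _ my = ≡.trans (my _) (sym (≡.trans (mx _) (my s)))
  ... | untouched _ mx     | untouched _ my    =
    ≡.trans (my _) (≡.trans (mx s) (sym (≡.trans (mx _) (my s))))

  module _ {k d s x} (ex : Empty T k d s x) where

    private
      s' : StateFn T
      s' = move T d s x

    kept : ∀ {W} → Outside x W → matched T s' W ≡ matched T s W
    kept {W} out with moveView d x W
    ... | untouched _ m     = cong (corner W) (m s)
    ... | reassigned j e _  = contradiction e (out j)

    moved : ∀ j → matched T s' (adj T x j) ≡ after d x j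
    moved j with moveView d x (adj T x j)
    ... | untouched out _    = contradiction refl (out j)
    ... | reassigned i e m with empty-neighbours-distinct ex e
    ...   | refl = ≡.trans (cong (corner (adj T x j)) (m s)) (target-vertex d x j)

    after-was-matched : ∀ j → ∃[ j' ] matched T s (adj T x j') ≡ after d x j
    after-was-matched j with after-among-before d x j
    ... | j' , e = j' , ≡.trans (empty-matched ex j') e

    before-is-matched : ∀ j → ∃[ j' ] matched T s' (adj T x j') ≡ before d x j
    before-is-matched j with before-among-after d x j
    ... | j' , e = j' , ≡.trans (moved j') e

    move-state : IsState T k s → IsState T k s'
    move-state st = record { maps-to = maps-to′ ; inj = inj′ ; surj = surj′ }
      where
        open IsState st

        outside-apart : ∀ {W} → ActiveTri T k W → Outside x W → ∀ j → matched T s' W ≢ matched T s' (adj T x j)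
        outside-apart {W} aW out j e with after-was-matched j
        ... | j' , e' = out j' (inj W (adj T x j') aW (empty-active ex j')
                                   (≡.trans (sym (kept out)) (≡.trans e (≡.trans (moved j) (sym e')))))

        maps-to′ : ∀ W → ActiveTri T k W → ActiveVert T k (matched T s' W)
        maps-to′ W aW with moveView d x W
        ... | untouched out _     = subst (ActiveVert T k) (sym (kept out)) (maps-to W aW)
        ... | reassigned j refl _ with after-was-matched j
        ...   | j' , e = subst (ActiveVert T k) (≡.trans e (sym (moved j))) (maps-to _ (empty-active ex j'))

        inj′ : ∀ W W' → ActiveTri T k W → ActiveTri T k W' → matched T s' W ≡ matched T s' W' → W ≡ W'
        inj′ W W' aW aW' e with moveView d x W | moveView d x W'
        ... | untouched out _     | untouched out' _     =
          inj W W' aW aW' (≡.trans (sym (kept out)) (≡.trans e (kept out')))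
        ... | reassigned i refl _ | reassigned j refl _  =
          cong (adj T x) (after-injective d x (≡.trans (sym (moved i)) (≡.trans e (moved j))))
        ... | untouched out _     | reassigned j refl _  = contradiction e (outside-apart aW out j)
        ... | reassigned i refl _ | untouched out' _     = contradiction (sym e) (outside-apart aW' out' i)

        surj′ : ∀ v → ActiveVert T k v → ∃[ W ] (ActiveTri T k W × matched T s' W ≡ v)
        surj′ v av with surj v av
        ... | W , aW , refl with moveView d x W
        ...   | untouched out _     = W , aW , kept out
        ...   | reassigned j refl _ with before-is-matched j
        ...     | j' , e = adj T x j' , empty-active ex j' , ≡.trans e (sym (empty-matched ex j))

    empty-preserved : ∀ {y} → Disjoint x y → Empty T k d s y → Empty T k d s' y
    empty-preserved dj ey = empty-from-neighbours ey λ i →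
      empty-active ey i , ≡.trans (kept (λ j e → dj j i (sym e))) (empty-matched ey i)

  Independent : List (Fin nT) → Set
  Independent = AllPairs Disjoint

  empties-independent : ∀ {k d s} {S : List (Fin nT)} → Unique S → All (Empty T k d s) S → Independent S
  empties-independent []            []          = []
  empties-independent (x∉S ∷ uniq) (ex ∷ exs) = apart x∉S exs ∷ empties-independent uniq exs
    where
      apart : ∀ {L} → All (_ ≢_) L → All (Empty T _ _ _) L → All (Disjoint _) L
      apart []           []          = []
      apart (x≢y ∷ x≢L) (ey ∷ eys) = empty-disjoint ex ey x≢y ∷ apart x≢L eys

  independent-resp-↭ : ∀ {L S} → L ↭ S → Independent L → Independent S
  independent-resp-↭ p =
    SetoidPermutation.AllPairs-resp-↭ (≡.setoid (Fin nT)) Disjoint-sym (resp₂ Disjoint) (↭⇒↭ₛ p)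

  changeable : ∀ {k d s} (L : List (Fin nT)) → IsState T k s → Independent L → All (Empty T k d s) L →
               Changeable T k d s L
  changeable []      st []           []          = st
  changeable (x ∷ L) st (x#L ∷ ind) (ex ∷ exs) =
    st , ex , changeable L (move-state ex st) ind (preserved x#L exs)
    where
      preserved : ∀ {M} → All (Disjoint x) M → All (Empty T _ _ _) M → All (Empty T _ _ (move T _ _ x)) M
      preserved []          []          = []
      preserved (dj ∷ djs) (ey ∷ eys) = empty-preserved ex dj ey ∷ preserved djs eys

  moveAll-↭ : ∀ d s {L S} → L ↭ S → Independent S → ∀ W → moveAll T d s L W ≡ moveAll T d s S W
  moveAll-↭ d s refl           _                    W = refl
  moveAll-↭ d s (prep x p)     (_ ∷ ind)            W = moveAll-↭ d (move T d s x) p ind W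
  moveAll-↭ d s (swap {ys = ys} x y p) ((y#x ∷ _) ∷ _ ∷ ind) W = ≡.trans
    (moveAll-↭ d (move T d (move T d s x) y) p ind W)
    (moveAll-cong d ys (moves-commute d s (Disjoint-sym y#x)) W)
  moveAll-↭ d s (trans p q)    ind                  W = ≡.trans
    (moveAll-↭ d s p (independent-resp-↭ (↭-sym q) ind) W) (moveAll-↭ d s q ind W)

lemma2p7 : (T : Trinity) (k : Kind T) (d : Dir T) (s : StateFn T) → IsState T k s →
           (S : List (Fin (Trinity.nT T))) → Unique S → All (Empty T k d s) S →
           (L : List (Fin (Trinity.nT T))) → L ↭ S →
           Changeable T k d s L × SameState T k (moveAll T d s L) (moveAll T d s S)
lemma2p7 T k d s st S uniq exs L L↭S =
  changeable T L st (independent-resp-↭ T S↭L indS) (All-resp-↭ S↭L exs) ,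
  λ W _ → moveAll-↭ T d s L↭S indS W
  where
    S↭L : S ↭ L
    S↭L = ↭-sym L↭S

    indS : Independent T S
    indS = empties-independent T uniq exs
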